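{- For every finite simple graph $G$, $b_2(G) \leq r_2(G)$.
   Context: For a finite simple graph $G=(V,E)$, a biclique on a subset of $V$ is given by two disjoint sets $X,Y\subseteq V$; its edges are all pairs $\{x,y\}$ with $x\in X$, $y\in Y$. An odd cover of $G$ is a collection of bicliques on subsets of $V$ such that every pair of vertices adjacent in $G$ is an edge of an odd number of the bicliques, and every pair of distinct non-adjacent vertices is an edge of an even number of the bicliques. $b_2(G)$ denotes the minimum cardinality of an odd cover of $G$. $r_2(G)$ denotes the rank over $\mathbb{F}_2$ of the adjacency matrix of $G$. -}

module Defs where

open import Data.Nat using (ℕ; _≤_)
open import Data.Bool using (Bool; true; false; _∧_; _∨_; _xor_)
open import Data.Fin using (Fin)
open import Data.Fin.Subset using (Subset; Side; inside; outside; _∈_; _⊆_; ∣_∣; Nonempty)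
open import Data.Vec using (lookup)
open import Data.List using (List; foldr; map; allFin; length)
open import Data.Product using (Σ; ∃; _×_)
open import Relation.Nullary using (¬_)
open import Relation.Binary.PropositionalEquality using (_≡_; _≢_)

record Graph (n : ℕ) : Set where
  field
    adj   : Fin n → Fin n → Bool
    sym   : ∀ u v → adj u v ≡ adj v u
    irrefl : ∀ u → adj u u ≡ false
open Graph public

mem : ∀ {n} → Fin n → Subset n → Bool
mem i S with lookup S i
... | inside  = true
... | outside = false

record Biclique (n : ℕ) : Set where
  field
    X Y      : Subset n
    disjoint : ∀ v → ¬ (v ∈ X × v ∈ Y)
open Biclique public

edgeOf : ∀ {n} → Biclique n → Fin n → Fin n → Bool
edgeOf B u v = (mem u (X B) ∧ mem v (Y B)) ∨ (mem v (X B) ∧ mem u (Y B))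

parity : ∀ {n} → List (Biclique n) → Fin n → Fin n → Bool
parity Bs u v = foldr (λ B acc → edgeOf B u v xor acc) false Bs

OddCover : ∀ {n} → Graph n → List (Biclique n) → Set
OddCover {n} G Bs = ∀ (u v : Fin n) → u ≢ v → parity Bs u v ≡ adj G u v

-- Matrices over F₂ (Bool with xor as addition, ∧ as multiplication).
Matrix₂ : ℕ → Set
Matrix₂ n = Fin n → Fin n → Bool

sumRows : ∀ {n} → Matrix₂ n → Subset n → Fin n → Bool
sumRows {n} A T j = foldr _xor_ false (map (λ i → mem i T ∧ A i j) (allFin n))

RowsIndependent : ∀ {n} → Matrix₂ n → Subset n → Set
RowsIndependent {n} A S =
  ∀ (T : Subset n) → T ⊆ S → Nonempty T → ¬ (∀ (j : Fin n) → sumRows A T j ≡ false)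

IsRank₂ : ∀ {n} → Matrix₂ n → ℕ → Set
IsRank₂ {n} A r =
  (∃ λ (S : Subset n) → RowsIndependent A S × ∣ S ∣ ≡ r)
  × (∀ (S : Subset n) → RowsIndependent A S → ∣ S ∣ ≤ r)

-- Symmetric Gaussian elimination over 𝔽₂. If A u v = 1 in the symmetric, zero-diagonal
-- adjacency matrix A, then adding x yᵀ + y xᵀ, where x and y are the rows v and u of A,
-- clears the rows and columns u and v. That rank-two matrix is the parity of two
-- bicliques, (x ∧ ¬y, y) and (x ∧ y, y ∧ ¬x), and any independent set of rows of the
-- reduced matrix stays independent in A after adding the rows u and v. Repeating until
-- the matrix vanishes yields an odd cover together with an independent set of rows of A
-- that is as large as the cover, so the cover has at most r₂(A) bicliques.
module Submission where

open import Defs hiding (sym)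

open import Data.Nat using (ℕ; zero; suc; _≤_; s≤s; z≤n)
open import Data.Nat.Properties using (≤-trans)
open import Data.Bool using (Bool; true; false; _∧_; _∨_; _xor_; not)
open import Data.Bool.Properties
  using (xor-∧-commutativeRing; xor-assoc; xor-same; xor-identityʳ; ∧-distribˡ-xor;
         ∧-zeroʳ; ∧-identityʳ; ∨-identityʳ; ¬-not)
  renaming (_≟_ to _≟ᵇ_)
open import Data.Fin using (Fin; zero; suc; _≟_; punchIn)
open import Data.Fin.Properties using (punchInᵢ≢i; any?)
open import Data.Fin.Subset using (Subset; _∈_; _∉_; _∪_; ⁅_⁆; ⊥; ∣_∣)
open import Data.Fin.Subset.Properties using (∉⊥; x∈p∪q⁻; x∈⁅y⁆⇒x≡y; ∪-identityʳ)
open import Data.Vec using (_∷_; lookup; tabulate; here; there)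
open import Data.Vec.Properties using (lookup∘tabulate; []=⇒lookup; lookup⇒[]=)
open import Data.Vec.Functional using (updateAt)
open import Data.Vec.Functional.Properties using (updateAt-updates; updateAt-minimal)
open import Data.List using (List; []; _∷_; length; foldr; allFin)
import Data.List as List
open import Data.List.Properties using (map-tabulate)
import Data.List.Relation.Unary.Any as Any
open import Data.List.Membership.Propositional using () renaming (_∉_ to _∉ₗ_)
open import Data.List.Membership.Propositional.Properties using (∈-allFin)
open import Data.Maybe using (just; nothing)
open import Data.Product using (Σ; _×_; _,_)
open import Data.Sum using (inj₁; inj₂)
open import Function using (_∘_; const)
open import Relation.Nullary using (yes; no; does; contradiction)
open import Relation.Nullary.Decidable using (dec-true; dec-false)
open import Relation.Binary.PropositionalEquality
open import Algebra.Bundles using (CommutativeRing)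
open import Algebra.Properties.Semiring.Sum (CommutativeRing.semiring xor-∧-commutativeRing)
  using (sum; sum-cong-≗; ∑-distrib-+; *-distribʳ-sum; sum-remove; sum-replicate-zero)
open import Tactic.RingSolver using (solve-∀)
open import Tactic.RingSolver.Core.AlmostCommutativeRing using (AlmostCommutativeRing; fromCommutativeRing)

𝔽₂ : AlmostCommutativeRing _ _
𝔽₂ = fromCommutativeRing xor-∧-commutativeRing λ { false → just refl ; true → nothing }

private
  variable
    n : ℕ

sum-supported-at : ∀ (f : Fin n → Bool) w → (∀ i → i ≢ w → f i ≡ false) → sum f ≡ f w
sum-supported-at {suc n} f w off = begin
  sum f                               ≡⟨ sum-remove {n} {w} f ⟩
  f w xor sum (λ k → f (punchIn w k)) ≡⟨ cong (f w xor_) (sum-cong-≗ {n} (off _ ∘ punchInᵢ≢i w)) ⟩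
  f w xor sum {n} (λ _ → false)       ≡⟨ cong (f w xor_) (sum-replicate-zero n) ⟩
  f w xor false                       ≡⟨ xor-identityʳ (f w) ⟩
  f w                                 ∎
  where open ≡-Reasoning

mem≡lookup : ∀ (i : Fin n) S → mem i S ≡ lookup S i
mem≡lookup i S with lookup S i
... | true  = refl
... | false = refl

∈⇒mem : ∀ {i : Fin n} {S} → i ∈ S → mem i S ≡ true
∈⇒mem {i = i} {S} i∈S = trans (mem≡lookup i S) ([]=⇒lookup i∈S)

mem⇒∈ : ∀ {i : Fin n} {S} → mem i S ≡ true → i ∈ S
mem⇒∈ {i = i} {S} e = lookup⇒[]= i S (trans (sym (mem≡lookup i S)) e)

mem-tabulate : ∀ (f : Fin n → Bool) i → mem i (tabulate f) ≡ f i
mem-tabulate f i = trans (mem≡lookup i (tabulate f)) (lookup∘tabulate f i)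

x∈p∪⁅y⁆⇒x∈p : ∀ {x y : Fin n} {p} → x ∈ p ∪ ⁅ y ⁆ → x ≢ y → x ∈ p
x∈p∪⁅y⁆⇒x∈p {y = y} {p} x∈ x≢y with x∈p∪q⁻ p ⁅ y ⁆ x∈
... | inj₁ x∈p = x∈p
... | inj₂ x∈y = contradiction (x∈⁅y⁆⇒x≡y y x∈y) x≢y

∣p∪⁅x⁆∣≡1+∣p∣ : ∀ {x : Fin n} (p : Subset n) → x ∉ p → ∣ p ∪ ⁅ x ⁆ ∣ ≡ suc ∣ p ∣
∣p∪⁅x⁆∣≡1+∣p∣ {x = zero}  (true  ∷ p) x∉p = contradiction here x∉p
∣p∪⁅x⁆∣≡1+∣p∣ {x = zero}  (false ∷ p) _   = cong (suc ∘ ∣_∣) (∪-identityʳ p)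
∣p∪⁅x⁆∣≡1+∣p∣ {x = suc x} (true  ∷ p) x∉p = cong suc (∣p∪⁅x⁆∣≡1+∣p∣ p (x∉p ∘ there))
∣p∪⁅x⁆∣≡1+∣p∣ {x = suc x} (false ∷ p) x∉p = ∣p∪⁅x⁆∣≡1+∣p∣ p (x∉p ∘ there)

dot : (Fin n → Bool) → (Fin n → Bool) → Bool
dot t x = sum (λ i → t i ∧ x i)

rowSum : Matrix₂ n → (Fin n → Bool) → Fin n → Bool
rowSum A t j = dot t (λ i → A i j)

foldr-xor-tabulate : ∀ (f : Fin n → Bool) → foldr _xor_ false (List.tabulate f) ≡ sum f
foldr-xor-tabulate {zero}  f = refl
foldr-xor-tabulate {suc n} f = cong (f zero xor_) (foldr-xor-tabulate (f ∘ suc))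

sumRows≡rowSum : ∀ (A : Matrix₂ n) T j → sumRows A T j ≡ rowSum A (λ i → mem i T) j
sumRows≡rowSum {n} A T j =
  trans (cong (foldr _xor_ false) (map-tabulate (λ i → i) entry)) (foldr-xor-tabulate entry)
  where
  entry : Fin n → Bool
  entry i = mem i T ∧ A i j

OnlyTrivialRelations : Matrix₂ n → Subset n → Set
OnlyTrivialRelations {n} A S =
  ∀ (t : Fin n → Bool) → (∀ i → t i ≡ true → i ∈ S) → (∀ j → rowSum A t j ≡ false) →
  ∀ i → t i ≡ false

onlyTrivialRelations⇒rowsIndependent : ∀ {A : Matrix₂ n} {S} →
  OnlyTrivialRelations A S → RowsIndependent A S
onlyTrivialRelations⇒rowsIndependent {A = A} indep T T⊆S (i , i∈T) T-rel =
  contradiction (trans (sym (∈⇒mem i∈T)) (indep (λ k → mem k T) (λ k → T⊆S ∘ mem⇒∈) rel i)) λ ()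
  where
  rel : ∀ j → rowSum A (λ k → mem k T) j ≡ false
  rel j = trans (sym (sumRows≡rowSum A T j)) (T-rel j)

⊥-onlyTrivialRelations : ∀ {A : Matrix₂ n} → OnlyTrivialRelations A ⊥
⊥-onlyTrivialRelations t t⊆⊥ _ i = ¬-not (∉⊥ ∘ t⊆⊥ i)

ZeroRow : Matrix₂ n → Fin n → Set
ZeroRow A i = ∀ j → A i j ≡ false

δ : Fin n → Fin n → Bool
δ w i = does (i ≟ w)

rowSum-δ : ∀ (A : Matrix₂ n) w j → rowSum A (δ w) j ≡ A w j
rowSum-δ A w j = trans (sum-supported-at _ w off) (cong (_∧ A w j) (dec-true (w ≟ w) refl))
  where
  off : ∀ i → i ≢ w → δ w i ∧ A i j ≡ false
  off i i≢w = cong (_∧ A i j) (dec-false (i ≟ w) i≢w)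

zeroRow∉ : ∀ {A : Matrix₂ n} {S w} → OnlyTrivialRelations A S → ZeroRow A w → w ∉ S
zeroRow∉ {A = A} {S} {w} indep w-zero w∈S =
  contradiction (trans (sym (dec-true (w ≟ w) refl)) (indep (δ w) δ⊆S rel w)) λ ()
  where
  δ⊆S : ∀ i → δ w i ≡ true → i ∈ S
  δ⊆S i _ with i ≟ w
  δ⊆S i _ | yes refl = w∈S
  rel : ∀ j → rowSum A (δ w) j ≡ false
  rel j = trans (rowSum-δ A w j) (w-zero j)

clear : (Fin n → Bool) → Fin n → Fin n → Bool
clear t w = updateAt t w (const false)

clear-true : ∀ (t : Fin n → Bool) {w i} → clear t w i ≡ true → i ≢ w × t i ≡ true
clear-true t {w} {i} e with i ≟ w
... | yes refl = contradiction (trans (sym e) (updateAt-updates w t)) λ ()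
... | no i≢w   = i≢w , trans (sym (updateAt-minimal i w t i≢w)) e

rowSum-clear : ∀ {A : Matrix₂ n} {w} t → ZeroRow A w → ∀ j → rowSum A (clear t w) j ≡ rowSum A t j
rowSum-clear {A = A} {w} t w-zero j = sum-cong-≗ pointwise
  where
  pointwise : ∀ i → clear t w i ∧ A i j ≡ t i ∧ A i j
  pointwise i with i ≟ w
  ... | yes refl = trans (cong (_∧ A w j) (updateAt-updates w t))
                          (sym (trans (cong (t w ∧_) (w-zero j)) (∧-zeroʳ (t w))))
  ... | no i≢w   = cong (_∧ A i j) (updateAt-minimal i w t i≢w)

∨-disjoint : ∀ a b c d → a ∧ b ≡ false → (a ∧ c) ∨ (d ∧ b) ≡ (a ∧ c) xor (d ∧ b)
∨-disjoint false _     _ _ _ = refl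
∨-disjoint true  false c d _ rewrite ∧-zeroʳ d | ∨-identityʳ c | xor-identityʳ c = refl

biclique : (X Y : Fin n → Bool) → (∀ i → X i ∧ Y i ≡ false) → Biclique n
biclique X Y disj = record
  { X        = tabulate X
  ; Y        = tabulate Y
  ; disjoint = λ i (i∈X , i∈Y) → contradiction
      (trans (sym (cong₂ _∧_ (from∈ X i∈X) (from∈ Y i∈Y))) (disj i)) λ ()
  }
  where
  from∈ : ∀ Z {i} → i ∈ tabulate Z → Z i ≡ true
  from∈ Z {i} i∈Z = trans (sym (mem-tabulate Z i)) (∈⇒mem i∈Z)

edgeOf-biclique : ∀ {X Y} disj (i j : Fin n) →
  edgeOf (biclique X Y disj) i j ≡ (X i ∧ Y j) xor (X j ∧ Y i)
edgeOf-biclique {X = X} {Y} disj i j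
  rewrite mem-tabulate X i | mem-tabulate Y i | mem-tabulate X j | mem-tabulate Y j =
  ∨-disjoint (X i) (Y i) (Y j) (X j) (disj i)

outerSum : (x y : Fin n → Bool) → Matrix₂ n
outerSum x y i j = (x i ∧ y j) xor (y i ∧ x j)

outerSum-disjoint₁ : ∀ (x y : Fin n → Bool) i → (x i ∧ not (y i)) ∧ y i ≡ false
outerSum-disjoint₁ x y i with x i | y i
... | false | _     = refl
... | true  | false = refl
... | true  | true  = refl

outerSum-disjoint₂ : ∀ (x y : Fin n → Bool) i → (x i ∧ y i) ∧ (y i ∧ not (x i)) ≡ false
outerSum-disjoint₂ x y i with x i | y i
... | false | _     = refl
... | true  | false = refl
... | true  | true  = refl

outerSum-biclique₁ outerSum-biclique₂ : (x y : Fin n → Bool) → Biclique n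
outerSum-biclique₁ x y = biclique (λ i → x i ∧ not (y i)) y (outerSum-disjoint₁ x y)
outerSum-biclique₂ x y = biclique (λ i → x i ∧ y i) (λ i → y i ∧ not (x i)) (outerSum-disjoint₂ x y)

edgeOf-outerSum-bicliques : ∀ (x y : Fin n → Bool) i j →
  edgeOf (outerSum-biclique₁ x y) i j xor edgeOf (outerSum-biclique₂ x y) i j ≡ outerSum x y i j
edgeOf-outerSum-bicliques x y i j = begin
  edgeOf (outerSum-biclique₁ x y) i j xor edgeOf (outerSum-biclique₂ x y) i j
    ≡⟨ cong₂ _xor_ (edgeOf-biclique (outerSum-disjoint₁ x y) i j)
                   (edgeOf-biclique (outerSum-disjoint₂ x y) i j) ⟩
  (((x i ∧ not (y i)) ∧ y j) xor ((x j ∧ not (y j)) ∧ y i)) xor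
  (((x i ∧ y i) ∧ (y j ∧ not (x j))) xor ((x j ∧ y j) ∧ (y i ∧ not (x i))))
    ≡⟨ identity (x i) (y i) (x j) (y j) ⟩
  outerSum x y i j ∎
  where
  open ≡-Reasoning
  -- not b is written as true xor b (definitionally equal) so that the ring solver sees 1 + b.
  identity : ∀ xi yi xj yj →
    (((xi ∧ (true xor yi)) ∧ yj) xor ((xj ∧ (true xor yj)) ∧ yi)) xor
    (((xi ∧ yi) ∧ (yj ∧ (true xor xj))) xor ((xj ∧ yj) ∧ (yi ∧ (true xor xi))))
    ≡ (xi ∧ yj) xor (yi ∧ xj)
  identity = solve-∀ 𝔽₂

-- Symmetric pivoting

Symmetric : Matrix₂ n → Set
Symmetric A = ∀ i j → A i j ≡ A j i

ZeroDiagonal : Matrix₂ n → Set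
ZeroDiagonal A = ∀ i → A i i ≡ false

rowSum-xor : ∀ (A B : Matrix₂ n) t j →
  rowSum (λ i k → A i k xor B i k) t j ≡ rowSum A t j xor rowSum B t j
rowSum-xor {n} A B t j =
  trans (sum-cong-≗ {n} (λ i → ∧-distribˡ-xor (t i) (A i j) (B i j))) (∑-distrib-+ {n} _ _)

rowSum-outerSum : ∀ (x y t : Fin n → Bool) j →
  rowSum (outerSum x y) t j ≡ (dot t x ∧ y j) xor (dot t y ∧ x j)
rowSum-outerSum {n} x y t j = begin
  sum (λ i → t i ∧ ((x i ∧ y j) xor (y i ∧ x j)))
    ≡⟨ sum-cong-≗ (λ i → distrib (t i) (x i) (y i) (y j) (x j)) ⟩
  sum (λ i → ((t i ∧ x i) ∧ y j) xor ((t i ∧ y i) ∧ x j))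
    ≡⟨ ∑-distrib-+ (λ i → (t i ∧ x i) ∧ y j) (λ i → (t i ∧ y i) ∧ x j) ⟩
  sum (λ i → (t i ∧ x i) ∧ y j) xor sum (λ i → (t i ∧ y i) ∧ x j)
    ≡⟨ sym (cong₂ _xor_ (*-distribʳ-sum (y j) (λ i → t i ∧ x i))
                        (*-distribʳ-sum (x j) (λ i → t i ∧ y i))) ⟩
  (dot t x ∧ y j) xor (dot t y ∧ x j) ∎
  where
  open ≡-Reasoning
  distrib : ∀ a b c d e → a ∧ ((b ∧ d) xor (c ∧ e)) ≡ ((a ∧ b) ∧ d) xor ((a ∧ c) ∧ e)
  distrib = solve-∀ 𝔽₂

dot-row≡rowSum : ∀ {A : Matrix₂ n} → Symmetric A → ∀ t w → dot t (A w) ≡ rowSum A t w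
dot-row≡rowSum A-sym t w = sum-cong-≗ (λ i → cong (t i ∧_) (A-sym w i))

pivot : Matrix₂ n → Fin n → Fin n → Matrix₂ n
pivot A u v i j = A i j xor outerSum (A v) (A u) i j

pivot-symmetric : ∀ {A : Matrix₂ n} → Symmetric A → ∀ u v → Symmetric (pivot A u v)
pivot-symmetric {A = A} A-sym u v i j =
  cong₂ _xor_ (A-sym i j) (swap (A v i) (A u j) (A u i) (A v j))
  where
  swap : ∀ a b c d → (a ∧ b) xor (c ∧ d) ≡ (d ∧ c) xor (b ∧ a)
  swap = solve-∀ 𝔽₂

pivot-zeroDiagonal : ∀ {A : Matrix₂ n} → ZeroDiagonal A → ∀ u v → ZeroDiagonal (pivot A u v)
pivot-zeroDiagonal {A = A} A-diag u v i =
  cong₂ _xor_ (A-diag i) (cancel (A v i) (A u i))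
  where
  cancel : ∀ a b → (a ∧ b) xor (b ∧ a) ≡ false
  cancel = solve-∀ 𝔽₂

pivot-zeroRow : ∀ {A : Matrix₂ n} → Symmetric A → ∀ {i} u v → ZeroRow A i → ZeroRow (pivot A u v) i
pivot-zeroRow {A = A} A-sym {i} u v i-zero j
  rewrite i-zero j | sym (A-sym i v) | i-zero v | sym (A-sym i u) | i-zero u = refl

-- Odd covers bounded by independent rows

record RankBoundedCover (A : Matrix₂ n) : Set where
  field
    bicliques       : List (Biclique n)
    covers          : ∀ i j → parity bicliques i j ≡ A i j
    independentRows : Subset n
    independent     : OnlyTrivialRelations A independentRows
    length≤∣rows∣   : length bicliques ≤ ∣ independentRows ∣

zeroMatrix-cover : ∀ {A : Matrix₂ n} → (∀ i → ZeroRow A i) → RankBoundedCover A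
zeroMatrix-cover A-zero = record
  { bicliques       = []
  ; covers          = λ i j → sym (A-zero i j)
  ; independentRows = ⊥
  ; independent     = ⊥-onlyTrivialRelations
  ; length≤∣rows∣   = z≤n
  }

rowSum-pair : ∀ {A : Matrix₂ n} {u v} t → ZeroDiagonal A → A u v ≡ true →
  (∀ i → i ≢ u → i ≢ v → t i ≡ false) → rowSum A t v ≡ t u
rowSum-pair {A = A} {u} {v} t A-diag Auv off =
  trans (sum-supported-at _ u vanish) (trans (cong (t u ∧_) Auv) (∧-identityʳ (t u)))
  where
  vanish : ∀ i → i ≢ u → t i ∧ A i v ≡ false
  vanish i i≢u with i ≟ v
  ... | yes refl = trans (cong (t v ∧_) (A-diag v)) (∧-zeroʳ (t v))
  ... | no i≢v   = cong (_∧ A i v) (off i i≢u i≢v)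

module Pivot {A : Matrix₂ n} (A-sym : Symmetric A) (A-diag : ZeroDiagonal A)
             {u v : Fin n} (Auv : A u v ≡ true) where

  A′ : Matrix₂ n
  A′ = pivot A u v

  Avu : A v u ≡ true
  Avu = trans (A-sym v u) Auv

  u≢v : u ≢ v
  u≢v refl = contradiction (trans (sym Auv) (A-diag u)) λ ()

  pivot-row-u : ZeroRow A′ u
  pivot-row-u j rewrite Avu | A-diag u | xor-identityʳ (A u j) = xor-same (A u j)

  pivot-row-v : ZeroRow A′ v
  pivot-row-v j rewrite A-diag v | Auv = xor-same (A v j)

  rowSum-pivot : ∀ t j →
    rowSum A′ t j ≡ rowSum A t j xor ((rowSum A t v ∧ A u j) xor (rowSum A t u ∧ A v j))
  rowSum-pivot t j = begin
    rowSum A′ t j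
      ≡⟨ rowSum-xor A (outerSum (A v) (A u)) t j ⟩
    rowSum A t j xor rowSum (outerSum (A v) (A u)) t j
      ≡⟨ cong (rowSum A t j xor_) (rowSum-outerSum (A v) (A u) t j) ⟩
    rowSum A t j xor ((dot t (A v) ∧ A u j) xor (dot t (A u) ∧ A v j))
      ≡⟨ cong₂ (λ α β → rowSum A t j xor ((α ∧ A u j) xor (β ∧ A v j)))
               (dot-row≡rowSum A-sym t v) (dot-row≡rowSum A-sym t u) ⟩
    rowSum A t j xor ((rowSum A t v ∧ A u j) xor (rowSum A t u ∧ A v j)) ∎
    where open ≡-Reasoning

  -- Columns u and v of a relation among the rows of A vanish, so it is also one for A′.
  pivot-relation : ∀ t → (∀ j → rowSum A t j ≡ false) → ∀ j → rowSum A′ t j ≡ false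
  pivot-relation t t-rel j = begin
    rowSum A′ t j
      ≡⟨ rowSum-pivot t j ⟩
    rowSum A t j xor ((rowSum A t v ∧ A u j) xor (rowSum A t u ∧ A v j))
      ≡⟨ cong₂ (λ α β → rowSum A t j xor ((α ∧ A u j) xor (β ∧ A v j))) (t-rel v) (t-rel u) ⟩
    rowSum A t j xor false
      ≡⟨ trans (xor-identityʳ _) (t-rel j) ⟩
    false ∎
    where open ≡-Reasoning

  pivot-independent : ∀ {S} → OnlyTrivialRelations A′ S →
                      OnlyTrivialRelations A ((S ∪ ⁅ u ⁆) ∪ ⁅ v ⁆)
  pivot-independent {S} indep t t⊆ t-rel = vanishes
    where
    t′ : Fin n → Bool
    t′ = clear (clear t u) v

    t′-rel : ∀ j → rowSum A′ t′ j ≡ false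
    t′-rel j = trans (rowSum-clear (clear t u) pivot-row-v j)
                     (trans (rowSum-clear t pivot-row-u j) (pivot-relation t t-rel j))

    t′⊆S : ∀ k → t′ k ≡ true → k ∈ S
    t′⊆S k e with clear-true (clear t u) e
    ... | k≢v , e′ with clear-true t e′
    ... | k≢u , tk = x∈p∪⁅y⁆⇒x∈p (x∈p∪⁅y⁆⇒x∈p (t⊆ k tk) k≢v) k≢u

    off : ∀ k → k ≢ u → k ≢ v → t k ≡ false
    off k k≢u k≢v = begin
      t k             ≡⟨ sym (updateAt-minimal k u t k≢u) ⟩
      clear t u k     ≡⟨ sym (updateAt-minimal k v (clear t u) k≢v) ⟩
      t′ k            ≡⟨ indep t′ t′⊆S t′-rel k ⟩
      false           ∎
      where open ≡-Reasoning

    t-u : t u ≡ false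
    t-u = trans (sym (rowSum-pair t A-diag Auv off)) (t-rel v)

    t-v : t v ≡ false
    t-v = trans (sym (rowSum-pair t A-diag Avu (λ k k≢v k≢u → off k k≢u k≢v))) (t-rel u)

    vanishes : ∀ i → t i ≡ false
    vanishes i with i ≟ u | i ≟ v
    ... | yes refl | _        = t-u
    ... | no _     | yes refl = t-v
    ... | no i≢u   | no i≢v   = off i i≢u i≢v

  pivot-cover : RankBoundedCover A′ → RankBoundedCover A
  pivot-cover R = record
    { bicliques       = B₁ ∷ B₂ ∷ bicliques
    ; covers          = covers′
    ; independentRows = (independentRows ∪ ⁅ u ⁆) ∪ ⁅ v ⁆
    ; independent     = pivot-independent independent
    ; length≤∣rows∣   = subst (_ ≤_) (sym card) (s≤s (s≤s length≤∣rows∣))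
    }
    where
    open RankBoundedCover R
    B₁ = outerSum-biclique₁ (A v) (A u)
    B₂ = outerSum-biclique₂ (A v) (A u)

    covers′ : ∀ i j → parity (B₁ ∷ B₂ ∷ bicliques) i j ≡ A i j
    covers′ i j = begin
      edgeOf B₁ i j xor (edgeOf B₂ i j xor parity bicliques i j)
        ≡⟨ sym (xor-assoc (edgeOf B₁ i j) _ _) ⟩
      (edgeOf B₁ i j xor edgeOf B₂ i j) xor parity bicliques i j
        ≡⟨ cong₂ _xor_ (edgeOf-outerSum-bicliques (A v) (A u) i j) (covers i j) ⟩
      outerSum (A v) (A u) i j xor (A i j xor outerSum (A v) (A u) i j)
        ≡⟨ cancel (A i j) (outerSum (A v) (A u) i j) ⟩
      A i j ∎
      where
      open ≡-Reasoning
      cancel : ∀ a b → b xor (a xor b) ≡ a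
      cancel = solve-∀ 𝔽₂

    u∉rows : u ∉ independentRows
    u∉rows = zeroRow∉ independent pivot-row-u

    v∉rows∪u : v ∉ independentRows ∪ ⁅ u ⁆
    v∉rows∪u v∈ = zeroRow∉ independent pivot-row-v (x∈p∪⁅y⁆⇒x∈p v∈ (u≢v ∘ sym))

    card : ∣ (independentRows ∪ ⁅ u ⁆) ∪ ⁅ v ⁆ ∣ ≡ suc (suc ∣ independentRows ∣)
    card = trans (∣p∪⁅x⁆∣≡1+∣p∣ _ v∉rows∪u) (cong suc (∣p∪⁅x⁆∣≡1+∣p∣ _ u∉rows))

zeroRows-∷ : ∀ {A : Matrix₂ n} {u vs} → ZeroRow A u → (∀ i → i ∉ₗ u ∷ vs → ZeroRow A i) →
  ∀ i → i ∉ₗ vs → ZeroRow A i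
zeroRows-∷ {u = u} u-zero zeros i i∉vs with i ≟ u
... | yes refl = u-zero
... | no i≢u   = zeros i λ { (Any.here i≡u) → i≢u i≡u ; (Any.there i∈vs) → i∉vs i∈vs }

rankBoundedCover : ∀ (vs : List (Fin n)) {A : Matrix₂ n} → Symmetric A → ZeroDiagonal A →
  (∀ i → i ∉ₗ vs → ZeroRow A i) → RankBoundedCover A
rankBoundedCover []       A-sym A-diag zeros = zeroMatrix-cover (λ i → zeros i λ ())
rankBoundedCover (u ∷ vs) {A} A-sym A-diag zeros with any? (λ j → A u j ≟ᵇ true)
... | no ¬nonzero = rankBoundedCover vs A-sym A-diag
        (zeroRows-∷ (λ j → ¬-not (¬nonzero ∘ (j ,_))) zeros)
... | yes (v , Auv) = Pivot.pivot-cover A-sym A-diag Auv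
        (rankBoundedCover vs (pivot-symmetric A-sym u v) (pivot-zeroDiagonal {A = A} A-diag u v)
          (zeroRows-∷ (Pivot.pivot-row-u A-sym A-diag Auv)
                      (λ i i∉ → pivot-zeroRow A-sym u v (zeros i i∉))))

mainTheorem2 : ∀ (n : ℕ) (G : Graph n) (r : ℕ) → IsRank₂ (adj G) r →
    Σ (List (Biclique n)) (λ Bs → OddCover G Bs × length Bs ≤ r)
mainTheorem2 n G r (_ , maximal) =
  bicliques , (λ u v _ → covers u v) ,
  ≤-trans length≤∣rows∣ (maximal independentRows (onlyTrivialRelations⇒rowsIndependent independent))
  where
  open RankBoundedCover
    (rankBoundedCover (allFin n) (Graph.sym G) (irrefl G) (λ i i∉ → contradiction (∈-allFin i) i∉))
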